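{- Let $\tau$ be a non-empty generalized pattern with no hyphens. Then for all $k\ge1$, $$\sum_{n\ge0}\sum_{\sigma\in[k]^n} y^{N_\tau(\sigma)}x^n=\frac{A_\tau(x;k)}{1-y\bigl((kx-1)A_\tau(x;k)+1\bigr)},$$ where $N_\tau(\sigma)$ is the maximum number of non-overlapping occurrences of $\tau$ in $\sigma$.
   Context: $[k]^n$ = words of length $n$ over $\{1,\dots,k\}$. A generalized pattern with no hyphens is a word $\tau=\tau_1\cdots\tau_m$ over $[\ell]$ using every letter of $[\ell]$. An occurrence of $\tau$ in $\sigma=\sigma_1\cdots\sigma_n$ is a factor $\sigma_i\cdots\sigma_{i+m-1}$ order-isomorphic to $\tau$ (i.e. $\sigma_{i+a-1}<\sigma_{i+b-1}$ iff $\tau_a<\tau_b$, and equality iff equality); two occurrences are non-overlapping if their sets of positions are disjoint. $\sigma$ avoids $\tau$ if it has no occurrence. $A_\tau(x;k)=\sum_{n\ge0}a_\tau(n;k)x^n$ with $a_\tau(n;k)$ the number of words in $[k]^n$ avoiding $\tau$ ($a_\tau(0;k)=1$). -}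

module Defs where

open import Data.Nat as ℕ using (ℕ; zero; suc; _+_; _∸_)
import Data.Nat.Properties as ℕP
open import Data.Integer as ℤ using (ℤ; +_)
open import Data.Fin as Fin using (Fin; toℕ)
import Data.Fin.Properties as FinP
open import Data.Fin.Subset using (Subset; _∈_; ∣_∣; inside; outside)
open import Data.Fin.Subset.Properties using (_∈?_)
open import Data.Vec as Vec using (Vec; []; _∷_; lookup)
open import Data.List as List using (List; []; _∷_; length; filter; concatMap)
open import Data.Product using (_×_; _,_)
open import Relation.Nullary using (¬_; Dec)
open import Relation.Nullary.Decidable using (_×-dec_; _→-dec_; ¬?)
open import Relation.Binary.PropositionalEquality using (_≡_; _≢_)

-- Words.  The alphabet [k] = {1,…,k} is represented by Fin k
-- (letters 0,…,k-1, with the same order), a word of length n is a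
-- Vec (Fin k) n; positions are Fin n (0-based).

Word : ℕ → ℕ → Set
Word k n = Vec (Fin k) n

allVec : ∀ {A : Set} → List A → (n : ℕ) → List (Vec A n)
allVec xs zero    = [] ∷ []
allVec xs (suc n) = concatMap (λ x → List.map (x ∷_) (allVec xs n)) xs

words : (k n : ℕ) → List (Word k n)
words k n = allVec (List.allFin k) n

subsets : (n : ℕ) → List (Subset n)
subsets n = allVec (inside ∷ outside ∷ []) n

SameOrder : ∀ {k ℓ} → Fin k → Fin k → Fin ℓ → Fin ℓ → Set
SameOrder x y u v =
  ((x Fin.< y → u Fin.< v) × (u Fin.< v → x Fin.< y)) ×
  ((x ≡ y → u ≡ v) × (u ≡ v → x ≡ y))

OccursAt : ∀ {ℓ m k n} → Vec (Fin ℓ) m → Word k n → Fin n → Set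
OccursAt {m = m} {n = n} τ σ s =
  (toℕ s + m ℕ.≤ n) ×
  (∀ (a b : Fin m) (p q : Fin n) →
     toℕ p ≡ toℕ s + toℕ a → toℕ q ≡ toℕ s + toℕ b →
     SameOrder (lookup σ p) (lookup σ q) (lookup τ a) (lookup τ b))

Avoids : ∀ {ℓ m k n} → Vec (Fin ℓ) m → Word k n → Set
Avoids {n = n} τ σ = ∀ (s : Fin n) → ¬ OccursAt τ σ s

InOcc : ∀ {n} → ℕ → Fin n → Fin n → Set
InOcc m s p = (toℕ s ℕ.≤ toℕ p) × (toℕ p ℕ.< toℕ s + m)

NonOverlapping : ∀ {ℓ m k n} → Vec (Fin ℓ) m → Word k n → Subset n → Set
NonOverlapping {m = m} {n = n} τ σ S =
  (∀ (s : Fin n) → s ∈ S → OccursAt τ σ s) ×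
  (∀ (s t : Fin n) → s ∈ S → t ∈ S → s ≢ t →
     ∀ (p : Fin n) → ¬ (InOcc m s p × InOcc m t p))

sameOrder? : ∀ {k ℓ} (x y : Fin k) (u v : Fin ℓ) → Dec (SameOrder x y u v)
sameOrder? x y u v =
  (((x Fin.<? y) →-dec (u Fin.<? v)) ×-dec ((u Fin.<? v) →-dec (x Fin.<? y))) ×-dec
  (((x Fin.≟ y) →-dec (u Fin.≟ v)) ×-dec ((u Fin.≟ v) →-dec (x Fin.≟ y)))

occursAt? : ∀ {ℓ m k n} (τ : Vec (Fin ℓ) m) (σ : Word k n) (s : Fin n) →
            Dec (OccursAt τ σ s)
occursAt? {m = m} {n = n} τ σ s =
  (toℕ s + m ℕ.≤? n) ×-dec
  FinP.all? λ a → FinP.all? λ b → FinP.all? λ p → FinP.all? λ q →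
    (toℕ p ℕ.≟ toℕ s + toℕ a) →-dec (toℕ q ℕ.≟ toℕ s + toℕ b) →-dec
    sameOrder? (lookup σ p) (lookup σ q) (lookup τ a) (lookup τ b)

avoids? : ∀ {ℓ m k n} (τ : Vec (Fin ℓ) m) (σ : Word k n) → Dec (Avoids τ σ)
avoids? τ σ = FinP.all? λ s → ¬? (occursAt? τ σ s)

inOcc? : ∀ {n} m (s p : Fin n) → Dec (InOcc m s p)
inOcc? m s p = (toℕ s ℕ.≤? toℕ p) ×-dec (toℕ p ℕ.<? toℕ s + m)

nonOverlapping? : ∀ {ℓ m k n} (τ : Vec (Fin ℓ) m) (σ : Word k n) (S : Subset n) →
                  Dec (NonOverlapping τ σ S)
nonOverlapping? {m = m} τ σ S =
  (FinP.all? λ s → (s ∈? S) →-dec occursAt? τ σ s) ×-dec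
  (FinP.all? λ s → FinP.all? λ t → (s ∈? S) →-dec (t ∈? S) →-dec
     ¬? (s FinP.≟ t) →-dec FinP.all? λ p → ¬? (inOcc? m s p ×-dec inOcc? m t p))

-- N_τ(σ): the maximum number of pairwise non-overlapping occurrences,
-- i.e. the maximum of ∣ S ∣ over all admissible sets S of starting
-- positions (the empty set is always admissible).

maxList : List ℕ → ℕ
maxList = List.foldr ℕ._⊔_ 0

N : ∀ {ℓ m k n} → Vec (Fin ℓ) m → Word k n → ℕ
N {n = n} τ σ = maxList (List.map ∣_∣ (filter (nonOverlapping? τ σ) (subsets n)))

a : ∀ {ℓ m} → Vec (Fin ℓ) m → (k n : ℕ) → ℕ
a τ k n = length (filter (avoids? τ) (words k n))

countN : ∀ {ℓ m} → Vec (Fin ℓ) m → (k n j : ℕ) → ℕ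
countN τ k n j = length (filter (λ σ → N τ σ ℕ.≟ j) (words k n))

-- Formal power series with integer coefficients.
-- Series  = ℕ → ℤ           (coefficient of x^n)
-- Series₂ = ℕ → ℕ → ℤ       (coefficient of x^n y^j)

Series : Set
Series = ℕ → ℤ

Series₂ : Set
Series₂ = ℕ → ℕ → ℤ

sumTo : ℕ → (ℕ → ℤ) → ℤ
sumTo zero    f = f 0
sumTo (suc n) f = sumTo n f ℤ.+ f (suc n)

const : ℤ → Series
const c zero    = c
const c (suc n) = + 0

X : Series
X 1 = + 1
X _ = + 0

_⊕_ : Series → Series → Series
(f ⊕ g) n = f n ℤ.+ g n

_⊖_ : Series → Series → Series
(f ⊖ g) n = f n ℤ.- g n

_⊗_ : Series → Series → Series
(f ⊗ g) n = sumTo n (λ i → f i ℤ.* g (n ∸ i))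

lift : Series → Series₂
lift f n zero    = f n
lift f n (suc j) = + 0

Y : Series₂
Y 0 1 = + 1
Y _ _ = + 0

_⊖₂_ : Series₂ → Series₂ → Series₂
(F ⊖₂ G) n j = F n j ℤ.- G n j

_⊗₂_ : Series₂ → Series₂ → Series₂
(F ⊗₂ G) n j = sumTo n (λ i → sumTo j (λ l → F i l ℤ.* G (n ∸ i) (j ∸ l)))

Aser : ∀ {ℓ m} → Vec (Fin ℓ) m → ℕ → Series
Aser τ k n = + a τ k n

Fser : ∀ {ℓ m} → Vec (Fin ℓ) m → ℕ → Series₂
Fser τ k n j = + countN τ k n j

Dser : ∀ {ℓ m} → Vec (Fin ℓ) m → ℕ → Series₂
Dser τ k = lift (const (+ 1)) ⊖₂
           (Y ⊗₂ lift ((((const (+ k) ⊗ X) ⊖ const (+ 1)) ⊗ Aser τ k) ⊕ const (+ 1)))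

{-# OPTIONS --safe #-}

-- A maximum family of non-overlapping occurrences can be chosen greedily from the left (an
-- exchange argument), so N_τ(uw) = 1 + N_τ(w) whenever the leftmost occurrence of τ in u is a
-- suffix of u.  Let F_j be the generating function of the words with N_τ = j, b_t the number of
-- words u of length t of this kind and B(x) = Σ b_t xᵗ; then F_0 = A and F_{j+1} = F_j B.  A
-- one-letter extension of a τ-avoiding word either still avoids τ or has its leftmost occurrence
-- at the end, so k x A = (A − 1) + B, i.e. B = (kx − 1) A + 1, and Σ_j F_j yʲ = A / (1 − yB).

module Submission where

open import Defs
open import Data.Nat using (ℕ; zero; suc; pred; _+_; _*_; _∸_; _≤_; _<_; z≤n; s≤s; s≤s⁻¹; _≟_; _≤?_)
open import Data.Nat.Properties
open import Data.Nat.ListAction using (sum)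
open import Data.Nat.ListAction.Properties using (sum-++)
open import Data.Integer as ℤ using (ℤ; +_; 0ℤ; -_; _-_)
import Data.Integer.Properties as ℤₚ
open import Data.Fin using (Fin; toℕ; zero; suc; _↑ˡ_)
open import Data.Fin.Properties using (toℕ-fromℕ<; toℕ-injective; toℕ<n; toℕ-↑ˡ)
open import Data.Fin.Subset using (Subset; _∈_; ∣_∣; inside; outside)
open import Data.Vec as Vec using (Vec; []; _∷_; lookup; here; there)
open import Data.Vec.Properties using (lookup-++-<; lookup-++ˡ)
open import Data.List as List using (List; []; _∷_; length; filter; map; concatMap; _++_)
import Data.List.Properties as List
open import Data.List.Membership.Propositional using () renaming (_∈_ to _∈ˡ_)
open import Data.List.Membership.Propositional.Properties using (∈-map⁺; ∈-filter⁺; ∈-concatMap⁺)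
open import Data.List.Relation.Unary.All as All using (All; []; _∷_)
open import Data.List.Relation.Unary.All.Properties using (all-filter; map⁺)
import Data.List.Relation.Unary.Any as Any
open import Data.Maybe as Maybe using (Maybe; just; nothing; fromMaybe)
open import Data.Maybe.Properties using (≡-dec)
open import Data.Product using (_×_; _,_; proj₁; proj₂; ∃; ∃-syntax)
open import Data.Sum as Sum using (_⊎_; inj₁; inj₂)
open import Data.Empty using (⊥-elim)
open import Function using (_∘_)
open import Relation.Nullary using (¬_; Dec; yes; no)
open import Relation.Nullary.Decidable using (_×-dec_)
open import Relation.Unary using (Decidable; Universal; ∁)
open import Relation.Unary.Properties using (_∪?_)
open import Relation.Binary.PropositionalEquality
open import Relation.Binary using (tri<; tri≈; tri>)
import Algebra.Properties.AbelianGroup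
import Algebra.Properties.CommutativeSemigroup

-- Counting in lists

count : {A : Set} {P : A → Set} → Decidable P → List A → ℕ
count P? = length ∘ filter P?

module _ {A : Set} {P : A → Set} (P? : Decidable P) where

  count-all : Universal P → ∀ xs → count P? xs ≡ length xs
  count-all all xs = cong length (List.filter-all P? (All.universal all xs))

  count-none : Universal (∁ P) → ∀ xs → count P? xs ≡ 0
  count-none none xs = cong length (List.filter-none P? (All.universal none xs))

  count-++ : ∀ xs ys → count P? (xs ++ ys) ≡ count P? xs + count P? ys
  count-++ xs ys = trans (cong length (List.filter-++ P? xs ys)) (List.length-++ (filter P? xs))

  count-concatMap : ∀ {B : Set} (f : B → List A) xs →
                    count P? (concatMap f xs) ≡ sum (map (count P? ∘ f) xs)
  count-concatMap f []       = refl
  count-concatMap f (x ∷ xs) = trans (count-++ (f x) _) (cong (_+_ (count P? (f x))) (count-concatMap f xs))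

  count-map : ∀ {B : Set} (f : B → A) xs → count P? (map f xs) ≡ count (P? ∘ f) xs
  count-map f [] = refl
  count-map f (x ∷ xs) with P? (f x)
  ... | yes _ = cong suc (count-map f xs)
  ... | no  _ = count-map f xs

  sum-indicator : ∀ (f : A → ℕ) c → (∀ x → P x → f x ≡ c) → (∀ x → ¬ P x → f x ≡ 0) →
                  ∀ xs → sum (map f xs) ≡ count P? xs * c
  sum-indicator f c on off [] = refl
  sum-indicator f c on off (x ∷ xs) with P? x
  ... | yes p = cong₂ _+_ (on x p) (sum-indicator f c on off xs)
  ... | no ¬p = cong₂ _+_ (off x ¬p) (sum-indicator f c on off xs)

module _ {A : Set} {P Q : A → Set} (P? : Decidable P) (Q? : Decidable Q) where

  count-≐ : (∀ x → P x → Q x) → (∀ x → Q x → P x) → ∀ xs → count P? xs ≡ count Q? xs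
  count-≐ P⊆Q Q⊆P xs = cong length (List.filter-≐ P? Q? ((λ {x} → P⊆Q x) , (λ {x} → Q⊆P x)) xs)

  count-∪ : (∀ x → P x → ¬ Q x) → ∀ xs → count (P? ∪? Q?) xs ≡ count P? xs + count Q? xs
  count-∪ disjoint []       = refl
  count-∪ disjoint (x ∷ xs) with P? x | Q? x
  ... | yes p | yes q = ⊥-elim (disjoint x p q)
  ... | yes _ | no  _ = cong suc (count-∪ disjoint xs)
  ... | no  _ | yes _ = trans (cong suc (count-∪ disjoint xs)) (sym (+-suc _ _))
  ... | no  _ | no  _ = count-∪ disjoint xs

sum-cong : ∀ {A : Set} {f g : A → ℕ} → (∀ x → f x ≡ g x) → ∀ xs → sum (map f xs) ≡ sum (map g xs)
sum-cong f≗g xs = cong sum (List.map-cong f≗g xs)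

sum-concatMap : ∀ {A B : Set} (g : B → ℕ) (f : A → List B) xs →
                sum (map g (concatMap f xs)) ≡ sum (map (λ x → sum (map g (f x))) xs)
sum-concatMap g f []       = refl
sum-concatMap g f (x ∷ xs) = begin
  sum (map g (f x ++ concatMap f xs))              ≡⟨ cong sum (List.map-++ g (f x) _) ⟩
  sum (map g (f x) ++ map g (concatMap f xs))      ≡⟨ sum-++ (map g (f x)) _ ⟩
  sum (map g (f x)) + sum (map g (concatMap f xs)) ≡⟨ cong (_+_ (sum (map g (f x)))) (sum-concatMap g f xs) ⟩
  sum (map g (f x)) + sum (map (λ x → sum (map g (f x))) xs) ∎
  where open ≡-Reasoning

maxList-≤ : ∀ {ns j} → All (_≤ j) ns → maxList ns ≤ j
maxList-≤ []           = z≤n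
maxList-≤ (n≤j ∷ ns≤j) = ⊔-lub n≤j (maxList-≤ ns≤j)

≤-maxList : ∀ {n ns} → n ∈ˡ ns → n ≤ maxList ns
≤-maxList (Any.here refl)  = m≤m⊔n _ _
≤-maxList (Any.there n∈ns) = ≤-trans (≤-maxList n∈ns) (m≤n⊔m _ _)

pred≤⇒≤suc : ∀ {m n} → pred m ≤ n → m ≤ suc n
pred≤⇒≤suc {zero}  _   = z≤n
pred≤⇒≤suc {suc m} m≤n = s≤s m≤n

module _ {A : Set} (xs : List A) where

  ∈-allVec : (∀ x → x ∈ˡ xs) → ∀ {n} (v : Vec A n) → v ∈ˡ allVec xs n
  ∈-allVec all []      = Any.here refl
  ∈-allVec all (x ∷ v) = ∈-concatMap⁺ _ (Any.map (λ { refl → ∈-map⁺ (x ∷_) (∈-allVec all v) }) (all x))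

  length-allVec-1 : length (allVec xs 1) ≡ length xs
  length-allVec-1 = begin
    length (concatMap (List.[_] ∘ (_∷ [])) xs)       ≡⟨ cong length (List.concatMap-map List.[_] (_∷ []) xs) ⟨
    length (concatMap List.[_] (map (_∷ []) xs))     ≡⟨ cong length (List.concatMap-pure (map (_∷ []) xs)) ⟩
    length (map (_∷ []) xs)                          ≡⟨ List.length-map _ xs ⟩
    length xs                                        ∎
    where open ≡-Reasoning

  count-allVec-++ : ∀ t r {P : Vec A (t + r) → Set} (P? : Decidable P) →
    count P? (allVec xs (t + r)) ≡ sum (map (λ u → count (λ w → P? (u Vec.++ w)) (allVec xs r)) (allVec xs t))
  count-allVec-++ zero    r P? = sym (+-identityʳ _)
  count-allVec-++ (suc t) r P? = begin
    count P? (concatMap (λ x → map (x ∷_) (allVec xs (t + r))) xs)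
      ≡⟨ count-concatMap P? _ xs ⟩
    sum (map (λ x → count P? (map (x ∷_) (allVec xs (t + r)))) xs)
      ≡⟨ sum-cong (λ x → trans (count-map P? (x ∷_) (allVec xs (t + r)))
                               (count-allVec-++ t r (λ v → P? (x ∷ v)))) xs ⟩
    sum (map (λ x → sum (map (h ∘ (x ∷_)) (allVec xs t))) xs)
      ≡⟨ sum-cong (λ x → cong sum (List.map-∘ (allVec xs t))) xs ⟩
    sum (map (λ x → sum (map h (map (x ∷_) (allVec xs t)))) xs)
      ≡⟨ sum-concatMap h (λ x → map (x ∷_) (allVec xs t)) xs ⟨
    sum (map h (allVec xs (suc t))) ∎
    where
    open ≡-Reasoning
    h : Vec A (suc t) → ℕ
    h u = count (λ w → P? (u Vec.++ w)) (allVec xs r)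

-- Finite sums and formal power series

sumTo-cong : ∀ n {f g : ℕ → ℤ} → (∀ {i} → i ≤ n → f i ≡ g i) → sumTo n f ≡ sumTo n g
sumTo-cong zero    f≗g = f≗g z≤n
sumTo-cong (suc n) f≗g = cong₂ ℤ._+_ (sumTo-cong n (f≗g ∘ m≤n⇒m≤1+n)) (f≗g ≤-refl)

sumTo-zero : ∀ n (f : ℕ → ℤ) → (∀ {i} → i ≤ n → f i ≡ 0ℤ) → sumTo n f ≡ 0ℤ
sumTo-zero zero    f f≡0 = f≡0 z≤n
sumTo-zero (suc n) f f≡0 = cong₂ ℤ._+_ (sumTo-zero n f (f≡0 ∘ m≤n⇒m≤1+n)) (f≡0 ≤-refl)

sumTo-single : ∀ n (f : ℕ → ℤ) {p} → p ≤ n → (∀ {i} → i ≤ n → i ≢ p → f i ≡ 0ℤ) →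
               sumTo n f ≡ f p
sumTo-single zero    f z≤n _ = refl
sumTo-single (suc n) f {p} p≤1+n others with m≤n⇒m<n∨m≡n p≤1+n
... | inj₁ (s≤s p≤n) = begin
  sumTo n f ℤ.+ f (suc n) ≡⟨ cong₂ ℤ._+_ (sumTo-single n f p≤n (others ∘ m≤n⇒m≤1+n))
                                        (others ≤-refl (λ 1+n≡p → 1+n≰n (subst (_≤ n) (sym 1+n≡p) p≤n))) ⟩
  f p ℤ.+ 0ℤ              ≡⟨ ℤₚ.+-identityʳ (f p) ⟩
  f p                     ∎
  where open ≡-Reasoning
... | inj₂ refl = begin
  sumTo n f ℤ.+ f (suc n) ≡⟨ cong (ℤ._+ f (suc n))
                                   (sumTo-zero n f (λ i≤n → others (m≤n⇒m≤1+n i≤n) λ { refl → 1+n≰n i≤n })) ⟩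
  0ℤ ℤ.+ f (suc n)        ≡⟨ ℤₚ.+-identityˡ (f (suc n)) ⟩
  f (suc n)               ∎
  where open ≡-Reasoning

sumTo-peel : ∀ n (f : ℕ → ℤ) → sumTo (suc n) f ≡ f 0 ℤ.+ sumTo n (f ∘ suc)
sumTo-peel zero    f = refl
sumTo-peel (suc n) f = trans (cong (ℤ._+ f (suc (suc n))) (sumTo-peel n f)) (ℤₚ.+-assoc (f 0) _ _)

sumTo-+ : ∀ n (f g : ℕ → ℤ) → sumTo n (λ i → f i ℤ.+ g i) ≡ sumTo n f ℤ.+ sumTo n g
sumTo-+ zero    f g = refl
sumTo-+ (suc n) f g = trans (cong (ℤ._+ (f (suc n) ℤ.+ g (suc n))) (sumTo-+ n f g))
                            (interchange (sumTo n f) (sumTo n g) (f (suc n)) (g (suc n)))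
  where open Algebra.Properties.CommutativeSemigroup ℤₚ.+-commutativeSemigroup using (interchange)

sumTo-neg : ∀ n (f : ℕ → ℤ) → sumTo n (λ i → - f i) ≡ - sumTo n f
sumTo-neg zero    f = refl
sumTo-neg (suc n) f = trans (cong (ℤ._+ (- f (suc n))) (sumTo-neg n f))
                            (sym (ℤₚ.neg-distrib-+ (sumTo n f) (f (suc n))))

module _ {A : Set} {P : A → Set} (P? : Decidable P) (g : A → ℕ) where

  private
    below : ∀ n → Decidable (λ x → P x × g x ≤ n)
    below n x = P? x ×-dec (g x ≤? n)

    at : ∀ i → Decidable (λ x → P x × g x ≡ i)
    at i x = P? x ×-dec (g x ≟ i)

  count-below : ∀ n xs → + count (below n) xs ≡ sumTo n (λ i → + count (at i) xs)
  count-below zero    xs = cong +_ (count-≐ (below 0) (at 0)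
    (λ _ (p , g≤0) → p , n≤0⇒n≡0 g≤0) (λ _ (p , g≡0) → p , ≤-reflexive g≡0) xs)
  count-below (suc n) xs = begin
    + count (below (suc n)) xs
      ≡⟨ cong +_ (count-≐ (below (suc n)) (below n ∪? at (suc n)) split join xs) ⟩
    + count (below n ∪? at (suc n)) xs
      ≡⟨ cong +_ (count-∪ (below n) (at (suc n)) disjoint xs) ⟩
    + (count (below n) xs + count (at (suc n)) xs)
      ≡⟨ ℤₚ.pos-+ (count (below n) xs) _ ⟩
    + count (below n) xs ℤ.+ + count (at (suc n)) xs
      ≡⟨ cong (ℤ._+ + count (at (suc n)) xs) (count-below n xs) ⟩
    sumTo (suc n) (λ i → + count (at i) xs) ∎
    where
    open ≡-Reasoning
    split : ∀ x → P x × g x ≤ suc n → (P x × g x ≤ n) ⊎ (P x × g x ≡ suc n)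
    split _ (p , g≤1+n) = Sum.map (λ { (s≤s g≤n) → p , g≤n }) (p ,_) (m≤n⇒m<n∨m≡n g≤1+n)
    join : ∀ x → (P x × g x ≤ n) ⊎ (P x × g x ≡ suc n) → P x × g x ≤ suc n
    join _ (inj₁ (p , g≤n))   = p , m≤n⇒m≤1+n g≤n
    join _ (inj₂ (p , g≡1+n)) = p , ≤-reflexive g≡1+n
    disjoint : ∀ x → P x × g x ≤ n → ¬ (P x × g x ≡ suc n)
    disjoint _ (_ , g≤n) (_ , g≡1+n) = 1+n≰n (subst (_≤ n) g≡1+n g≤n)

  count-by-value : ∀ n → (∀ x → g x ≤ n) → ∀ xs →
                   + count P? xs ≡ sumTo n (λ i → + count (λ x → P? x ×-dec (g x ≟ i)) xs)
  count-by-value n bounded xs =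
    trans (cong +_ (count-≐ P? (below n) (λ x p → p , bounded x) (λ _ → proj₁) xs)) (count-below n xs)

⊗-congʳ : ∀ (f : Series) {g h : Series} → (∀ t → g t ≡ h t) → ∀ n → (f ⊗ g) n ≡ (f ⊗ h) n
⊗-congʳ f g≗h n = sumTo-cong n (λ {i} _ → cong (f i ℤ.*_) (g≗h (n ∸ i)))

1-Y⊗ : Series → Series₂
1-Y⊗ g = lift (const (+ 1)) ⊖₂ (Y ⊗₂ lift g)

Y⊗₂-zero : ∀ (G : Series₂) n → (Y ⊗₂ G) n 0 ≡ 0ℤ
Y⊗₂-zero G n = sumTo-zero n (λ i → Y i 0 ℤ.* G (n ∸ i) 0) (λ { {zero} _ → refl ; {suc i} _ → refl })

Y⊗₂-suc : ∀ (G : Series₂) n j → (Y ⊗₂ G) n (suc j) ≡ G n j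
Y⊗₂-suc G n j = begin
  sumTo n (λ i → sumTo (suc j) (term i)) ≡⟨ sumTo-single n (λ i → sumTo (suc j) (term i)) z≤n rowsVanish ⟩
  sumTo (suc j) (term 0)                 ≡⟨ sumTo-single (suc j) (term 0) (s≤s z≤n) columnsVanish ⟩
  + 1 ℤ.* G n j                          ≡⟨ ℤₚ.*-identityˡ (G n j) ⟩
  G n j                                  ∎
  where
  open ≡-Reasoning
  term : ℕ → ℕ → ℤ
  term i l = Y i l ℤ.* G (n ∸ i) (suc j ∸ l)

  rowsVanish : ∀ {i} → i ≤ n → i ≢ 0 → sumTo (suc j) (term i) ≡ 0ℤ
  rowsVanish {zero}  _ 0≢0 = ⊥-elim (0≢0 refl)
  rowsVanish {suc i} _ _   = sumTo-zero (suc j) (term (suc i)) (λ _ → refl)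

  columnsVanish : ∀ {l} → l ≤ suc j → l ≢ 1 → term 0 l ≡ 0ℤ
  columnsVanish {zero}        _ _   = refl
  columnsVanish {suc zero}    _ 1≢1 = ⊥-elim (1≢1 refl)
  columnsVanish {suc (suc l)} _ _   = refl

const-∸ : ∀ c {i n} → i < n → const c (n ∸ i) ≡ 0ℤ
const-∸ c {i} (s≤s i≤n) rewrite +-∸-assoc 1 i≤n = refl

module _ (g : Series) where

  1-Y⊗-zero : ∀ p → 1-Y⊗ g p 0 ≡ const (+ 1) p
  1-Y⊗-zero p = trans (cong (λ z → const (+ 1) p - z) (Y⊗₂-zero (lift g) p)) (ℤₚ.+-identityʳ _)

  1-Y⊗-one : ∀ p → 1-Y⊗ g p 1 ≡ - g p
  1-Y⊗-one p = trans (cong (λ z → 0ℤ - z) (Y⊗₂-suc (lift g) p 0)) (ℤₚ.+-identityˡ _)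

  1-Y⊗-vanishes : ∀ p {l j} → l < j → 1-Y⊗ g p (suc j ∸ l) ≡ 0ℤ
  1-Y⊗-vanishes p {zero}  {suc j} _         = cong (λ z → 0ℤ - z) (Y⊗₂-suc (lift g) p (suc j))
  1-Y⊗-vanishes p {suc l} {suc j} (s≤s l<j) = 1-Y⊗-vanishes p l<j

  sumTo-*-1-Y⊗-zero : ∀ n (f : ℕ → ℤ) → sumTo n (λ i → f i ℤ.* 1-Y⊗ g (n ∸ i) 0) ≡ f n
  sumTo-*-1-Y⊗-zero n f = begin
    sumTo n (λ i → f i ℤ.* 1-Y⊗ g (n ∸ i) 0)
      ≡⟨ sumTo-single n (λ i → f i ℤ.* 1-Y⊗ g (n ∸ i) 0) ≤-refl vanish ⟩
    f n ℤ.* 1-Y⊗ g (n ∸ n) 0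
      ≡⟨ cong (λ p → f n ℤ.* 1-Y⊗ g p 0) (n∸n≡0 n) ⟩
    f n ℤ.* 1-Y⊗ g 0 0
      ≡⟨ cong (f n ℤ.*_) (1-Y⊗-zero 0) ⟩
    f n ℤ.* + 1
      ≡⟨ ℤₚ.*-identityʳ (f n) ⟩
    f n ∎
    where
    open ≡-Reasoning
    vanish : ∀ {i} → i ≤ n → i ≢ n → f i ℤ.* 1-Y⊗ g (n ∸ i) 0 ≡ 0ℤ
    vanish {i} i≤n i≢n = begin
      f i ℤ.* 1-Y⊗ g (n ∸ i) 0    ≡⟨ cong (f i ℤ.*_) (1-Y⊗-zero (n ∸ i)) ⟩
      f i ℤ.* const (+ 1) (n ∸ i) ≡⟨ cong (f i ℤ.*_) (const-∸ (+ 1) (≤∧≢⇒< i≤n i≢n)) ⟩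
      f i ℤ.* 0ℤ                  ≡⟨ ℤₚ.*-zeroʳ (f i) ⟩
      0ℤ                          ∎

  ⊗₂-1-Y⊗-zero : ∀ (F : Series₂) n → (F ⊗₂ 1-Y⊗ g) n 0 ≡ F n 0
  ⊗₂-1-Y⊗-zero F n = sumTo-*-1-Y⊗-zero n (λ i → F i 0)

  ⊗₂-1-Y⊗-suc : ∀ (F : Series₂) n j → (F ⊗₂ 1-Y⊗ g) n (suc j) ≡ F n (suc j) - ((λ i → F i j) ⊗ g) n
  ⊗₂-1-Y⊗-suc F n j = begin
    sumTo n (λ i → sumTo (suc j) (λ l → F i l ℤ.* 1-Y⊗ g (n ∸ i) (suc j ∸ l)))
      ≡⟨ sumTo-cong n (λ {i} _ → inner i) ⟩
    sumTo n (λ i → - (F i j ℤ.* g (n ∸ i)) ℤ.+ F i (suc j) ℤ.* 1-Y⊗ g (n ∸ i) 0)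
      ≡⟨ sumTo-+ n _ _ ⟩
    sumTo n (λ i → - (F i j ℤ.* g (n ∸ i))) ℤ.+ sumTo n (λ i → F i (suc j) ℤ.* 1-Y⊗ g (n ∸ i) 0)
      ≡⟨ cong₂ ℤ._+_ (sumTo-neg n _) (sumTo-*-1-Y⊗-zero n (λ i → F i (suc j))) ⟩
    - ((λ i → F i j) ⊗ g) n ℤ.+ F n (suc j)
      ≡⟨ ℤₚ.+-comm _ (F n (suc j)) ⟩
    F n (suc j) - ((λ i → F i j) ⊗ g) n ∎
    where
    open ≡-Reasoning
    inner : ∀ i → sumTo (suc j) (λ l → F i l ℤ.* 1-Y⊗ g (n ∸ i) (suc j ∸ l))
                ≡ - (F i j ℤ.* g (n ∸ i)) ℤ.+ F i (suc j) ℤ.* 1-Y⊗ g (n ∸ i) 0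
    inner i = cong₂ ℤ._+_
      (begin
        sumTo j (λ l → F i l ℤ.* 1-Y⊗ g (n ∸ i) (suc j ∸ l))
          ≡⟨ sumTo-single j (λ l → F i l ℤ.* 1-Y⊗ g (n ∸ i) (suc j ∸ l)) ≤-refl vanish ⟩
        F i j ℤ.* 1-Y⊗ g (n ∸ i) (suc j ∸ j)
          ≡⟨ cong (λ l → F i j ℤ.* 1-Y⊗ g (n ∸ i) l) (m+n∸n≡m 1 j) ⟩
        F i j ℤ.* 1-Y⊗ g (n ∸ i) 1
          ≡⟨ cong (F i j ℤ.*_) (1-Y⊗-one (n ∸ i)) ⟩
        F i j ℤ.* - g (n ∸ i)
          ≡⟨ ℤₚ.neg-distribʳ-* (F i j) (g (n ∸ i)) ⟨
        - (F i j ℤ.* g (n ∸ i)) ∎)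
      (cong (λ l → F i (suc j) ℤ.* 1-Y⊗ g (n ∸ i) l) (n∸n≡0 j))
      where
      vanish : ∀ {l} → l ≤ j → l ≢ j → F i l ℤ.* 1-Y⊗ g (n ∸ i) (suc j ∸ l) ≡ 0ℤ
      vanish {l} l≤j l≢j =
        trans (cong (F i l ℤ.*_) (1-Y⊗-vanishes (n ∸ i) (≤∧≢⇒< l≤j l≢j))) (ℤₚ.*-zeroʳ (F i l))

module _ (c : ℤ) (f : Series) where

  private
    K : Series
    K = (const c ⊗ X) ⊖ const (+ 1)

    cX : ∀ i → (const c ⊗ X) i ≡ c ℤ.* X i
    cX i = sumTo-single i (λ l → const c l ℤ.* X (i ∸ l)) z≤n
             (λ { {zero} _ 0≢0 → ⊥-elim (0≢0 refl) ; {suc l} _ _ → refl })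

    K-zero : K 0 ≡ - + 1
    K-zero = cong (ℤ._- + 1) (ℤₚ.*-zeroʳ c)

    K-one : K 1 ≡ c
    K-one = trans (ℤₚ.+-identityʳ _) (trans (cX 1) (ℤₚ.*-identityʳ c))

    K-suc-suc : ∀ i → K (suc (suc i)) ≡ 0ℤ
    K-suc-suc i = trans (ℤₚ.+-identityʳ _) (trans (cX (suc (suc i))) (ℤₚ.*-zeroʳ c))

  [cX-1]f+1-zero : ((((const c ⊗ X) ⊖ const (+ 1)) ⊗ f) ⊕ const (+ 1)) 0 ≡ + 1 - f 0
  [cX-1]f+1-zero = begin
    K 0 ℤ.* f 0 ℤ.+ + 1  ≡⟨ cong (λ k₀ → k₀ ℤ.* f 0 ℤ.+ + 1) K-zero ⟩
    - + 1 ℤ.* f 0 ℤ.+ + 1 ≡⟨ cong (ℤ._+ + 1) (ℤₚ.-1*i≡-i (f 0)) ⟩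
    - f 0 ℤ.+ + 1         ≡⟨ ℤₚ.+-comm (- f 0) (+ 1) ⟩
    + 1 - f 0             ∎
    where open ≡-Reasoning

  [cX-1]f+1-suc : ∀ t → ((((const c ⊗ X) ⊖ const (+ 1)) ⊗ f) ⊕ const (+ 1)) (suc t) ≡ c ℤ.* f t - f (suc t)
  [cX-1]f+1-suc t = begin
    (K ⊗ f) (suc t) ℤ.+ 0ℤ
      ≡⟨ ℤₚ.+-identityʳ _ ⟩
    sumTo (suc t) (λ l → K l ℤ.* f (suc t ∸ l))
      ≡⟨ sumTo-peel t (λ l → K l ℤ.* f (suc t ∸ l)) ⟩
    K 0 ℤ.* f (suc t) ℤ.+ sumTo t (λ l → K (suc l) ℤ.* f (t ∸ l))
      ≡⟨ cong (ℤ._+_ (K 0 ℤ.* f (suc t))) (sumTo-single t (λ l → K (suc l) ℤ.* f (t ∸ l)) z≤n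
           (λ { {zero} _ 0≢0 → ⊥-elim (0≢0 refl)
              ; {suc l} _ _ → trans (cong (ℤ._* f (t ∸ suc l)) (K-suc-suc l))
                                    (ℤₚ.*-zeroˡ (f (t ∸ suc l))) })) ⟩
    K 0 ℤ.* f (suc t) ℤ.+ K 1 ℤ.* f t
      ≡⟨ cong₂ (λ k₀ k₁ → k₀ ℤ.* f (suc t) ℤ.+ k₁ ℤ.* f t) K-zero K-one ⟩
    - + 1 ℤ.* f (suc t) ℤ.+ c ℤ.* f t
      ≡⟨ cong (ℤ._+ c ℤ.* f t) (ℤₚ.-1*i≡-i (f (suc t))) ⟩
    - f (suc t) ℤ.+ c ℤ.* f t
      ≡⟨ ℤₚ.+-comm (- f (suc t)) (c ℤ.* f t) ⟩
    c ℤ.* f t - f (suc t) ∎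
    where open ≡-Reasoning

-- Occurrences and the greedy count

module _ {ℓ m k : ℕ} (τ : Vec (Fin ℓ) m) where

  occursAt-suc⁻ : ∀ {n} x (σ : Word k n) s → OccursAt τ (x ∷ σ) (suc s) → OccursAt τ σ s
  occursAt-suc⁻ x σ s (fits , iso) =
    s≤s⁻¹ fits , λ a b p q p≡ q≡ → iso a b (suc p) (suc q) (cong suc p≡) (cong suc q≡)

  occursAt-suc⁺ : ∀ {n} x (σ : Word k n) s → OccursAt τ σ s → OccursAt τ (x ∷ σ) (suc s)
  occursAt-suc⁺ x σ s (fits , iso) = s≤s fits , λ
    { a b zero    _       ()  _
    ; a b (suc p) zero    _   ()
    ; a b (suc p) (suc q) p≡ q≡ → iso a b p q (suc-injective p≡) (suc-injective q≡) }

  module _ {t r} (u : Word k (suc t)) (w : Word k r) where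

    occursAt-++⁻ : m ≤ suc t → OccursAt τ (u Vec.++ w) zero → OccursAt τ u zero
    occursAt-++⁻ m≤1+t (_ , iso) = m≤1+t , λ a b p q p≡ q≡ →
      subst₂ (λ x y → SameOrder x y (lookup τ a) (lookup τ b)) (lookup-++ˡ u w p) (lookup-++ˡ u w q)
        (iso a b (p ↑ˡ r) (q ↑ˡ r) (trans (toℕ-↑ˡ p r) p≡) (trans (toℕ-↑ˡ q r) q≡))

    occursAt-++⁺ : OccursAt τ u zero → OccursAt τ (u Vec.++ w) zero
    occursAt-++⁺ (m≤1+t , iso) = ≤-trans m≤1+t (m≤m+n (suc t) r) , λ a b p q p≡ q≡ →
      subst₂ (λ x y → SameOrder x y (lookup τ a) (lookup τ b))
        (sym (lookup-++-< u w p (inU a p p≡))) (sym (lookup-++-< u w q (inU b q q≡)))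
        (iso a b _ _ (trans (toℕ-fromℕ< (inU a p p≡)) p≡) (trans (toℕ-fromℕ< (inU b q q≡)) q≡))
      where
      inU : ∀ (a : Fin m) (p : Fin (suc t + r)) → toℕ p ≡ toℕ a → toℕ p < suc t
      inU a p p≡a = subst (_< suc t) (sym p≡a) (<-≤-trans (toℕ<n a) m≤1+t)

  -- The length of the shortest prefix of σ in which τ occurs, if any.
  firstEnd : ∀ {n} → Word k n → Maybe ℕ
  firstEnd []      = nothing
  firstEnd (x ∷ σ) with occursAt? τ (x ∷ σ) zero
  ... | yes _ = just m
  ... | no  _ = Maybe.map suc (firstEnd σ)

  firstEnd-bounds : ∀ {n} (σ : Word k n) {e} → firstEnd σ ≡ just e → m ≤ e × e ≤ n
  firstEnd-bounds (x ∷ σ) eq with occursAt? τ (x ∷ σ) zero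
  firstEnd-bounds (x ∷ σ) refl | yes (fits , _) = ≤-refl , fits
  ... | no _ with firstEnd σ in eqσ
  firstEnd-bounds (x ∷ σ) refl | no _ | just e =
    let m≤e , e≤n = firstEnd-bounds σ eqσ in m≤n⇒m≤1+n m≤e , s≤s e≤n

  firstEnd-fits : ∀ {n} (σ : Word k n) {e} → firstEnd σ ≡ just e → m ≤ n
  firstEnd-fits σ ends = let m≤e , e≤n = firstEnd-bounds σ ends in ≤-trans m≤e e≤n

  firstEnd≡nothing⇒avoids : ∀ {n} (σ : Word k n) → firstEnd σ ≡ nothing → Avoids τ σ
  firstEnd≡nothing⇒avoids []      _  ()
  firstEnd≡nothing⇒avoids (x ∷ σ) eq with occursAt? τ (x ∷ σ) zero
  ... | no ¬occ with firstEnd σ in eqσ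
  firstEnd≡nothing⇒avoids (x ∷ σ) refl | no ¬occ | nothing = λ
    { zero    occ → ¬occ occ
    ; (suc s) occ → firstEnd≡nothing⇒avoids σ eqσ s (occursAt-suc⁻ x σ s occ) }

  avoids⇒firstEnd≡nothing : ∀ {n} (σ : Word k n) → Avoids τ σ → firstEnd σ ≡ nothing
  avoids⇒firstEnd≡nothing []      _      = refl
  avoids⇒firstEnd≡nothing (x ∷ σ) avoids with occursAt? τ (x ∷ σ) zero
  ... | yes occ = ⊥-elim (avoids zero occ)
  ... | no  _   = cong (Maybe.map suc)
                       (avoids⇒firstEnd≡nothing σ (λ s occ → avoids (suc s) (occursAt-suc⁺ x σ s occ)))

  firstEnd-++⁺ : ∀ {t r} (u : Word k t) (w : Word k r) {e} →
                 firstEnd u ≡ just e → firstEnd (u Vec.++ w) ≡ just e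
  firstEnd-++⁺ {suc t} (x ∷ u) w eq
    with occursAt? τ (x ∷ u) zero | occursAt? τ (x ∷ (u Vec.++ w)) zero
  ... | yes _   | yes _    = eq
  ... | yes occ | no ¬occ′ = ⊥-elim (¬occ′ (occursAt-++⁺ (x ∷ u) w occ))
  ... | no ¬occ | yes occ′ with firstEnd u in eqᵤ
  firstEnd-++⁺ {suc t} (x ∷ u) w refl | no ¬occ | yes occ′ | just _ =
    ⊥-elim (¬occ (occursAt-++⁻ (x ∷ u) w (m≤n⇒m≤1+n (firstEnd-fits u eqᵤ)) occ′))
  firstEnd-++⁺ {suc t} (x ∷ u) w eq | no _ | no _ with firstEnd u in eqᵤ
  firstEnd-++⁺ {suc t} (x ∷ u) w refl | no _ | no _ | just _ =
    cong (Maybe.map suc) (firstEnd-++⁺ u w eqᵤ)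

  firstEnd-++⁻ : 1 ≤ m → ∀ {t r} (u : Word k t) (w : Word k r) {e} →
                 firstEnd (u Vec.++ w) ≡ just e → e ≤ t → firstEnd u ≡ just e
  firstEnd-++⁻ 1≤m [] w eq e≤0 =
    ⊥-elim (1+n≰n (≤-trans 1≤m (≤-trans (proj₁ (firstEnd-bounds w eq)) e≤0)))
  firstEnd-++⁻ 1≤m {suc t} (x ∷ u) w eq e≤1+t
    with occursAt? τ (x ∷ u) zero | occursAt? τ (x ∷ (u Vec.++ w)) zero
  ... | yes _   | yes _    = eq
  ... | yes occ | no ¬occ′ = ⊥-elim (¬occ′ (occursAt-++⁺ (x ∷ u) w occ))
  firstEnd-++⁻ 1≤m {suc t} (x ∷ u) w refl m≤1+t | no ¬occ | yes occ′ =
    ⊥-elim (¬occ (occursAt-++⁻ (x ∷ u) w m≤1+t occ′))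
  ... | no _ | no _ with firstEnd (u Vec.++ w) in eq′
  firstEnd-++⁻ 1≤m {suc t} (x ∷ u) w refl (s≤s e≤t) | no _ | no _ | just _ =
    cong (Maybe.map suc) (firstEnd-++⁻ 1≤m u w eq′ e≤t)

  -- Leftmost-first count of non-overlapping occurrences starting at positions ≥ d.
  greedy : ∀ {n} → ℕ → Word k n → ℕ
  greedy d       []      = 0
  greedy (suc d) (x ∷ σ) = greedy d σ
  greedy zero    (x ∷ σ) with occursAt? τ (x ∷ σ) zero
  ... | yes _ = suc (greedy (pred m) σ)
  ... | no  _ = greedy zero σ

  greedy-skip : ∀ {t r} (u : Word k t) (w : Word k r) → greedy t (u Vec.++ w) ≡ greedy 0 w
  greedy-skip []      w = refl
  greedy-skip (x ∷ u) w = greedy-skip u w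

  greedy-++ : ∀ {t r} (u : Word k t) (w : Word k r) → firstEnd u ≡ just t →
              greedy 0 (u Vec.++ w) ≡ suc (greedy 0 w)
  greedy-++ {suc t} (x ∷ u) w eq
    with occursAt? τ (x ∷ u) zero | occursAt? τ (x ∷ (u Vec.++ w)) zero
  greedy-++ {suc t} (x ∷ u) w refl | yes _ | yes _ = cong suc (greedy-skip u w)
  ... | yes occ | no ¬occ′ = ⊥-elim (¬occ′ (occursAt-++⁺ (x ∷ u) w occ))
  ... | no ¬occ | yes occ′ with firstEnd u in eqᵤ
  greedy-++ {suc t} (x ∷ u) w refl | no ¬occ | yes occ′ | just _ =
    ⊥-elim (¬occ (occursAt-++⁻ (x ∷ u) w (m≤n⇒m≤1+n (firstEnd-fits u eqᵤ)) occ′))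
  greedy-++ {suc t} (x ∷ u) w eq | no _ | no _ with firstEnd u in eqᵤ
  greedy-++ {suc t} (x ∷ u) w refl | no _ | no _ | just _ = greedy-++ u w eqᵤ

  greedy≡0⇒firstEnd≡nothing : ∀ {n} (σ : Word k n) → greedy 0 σ ≡ 0 → firstEnd σ ≡ nothing
  greedy≡0⇒firstEnd≡nothing []      _  = refl
  greedy≡0⇒firstEnd≡nothing (x ∷ σ) eq with occursAt? τ (x ∷ σ) zero
  ... | no _ = cong (Maybe.map suc) (greedy≡0⇒firstEnd≡nothing σ eq)

  firstEnd≡nothing⇒greedy≡0 : ∀ {n} (σ : Word k n) → firstEnd σ ≡ nothing → greedy 0 σ ≡ 0
  firstEnd≡nothing⇒greedy≡0 []      _  = refl
  firstEnd≡nothing⇒greedy≡0 (x ∷ σ) eq with occursAt? τ (x ∷ σ) zero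
  ... | no _ with firstEnd σ in eqσ
  ... | nothing = firstEnd≡nothing⇒greedy≡0 σ eqσ

  Spaced : ∀ {n} → Word k n → Subset n → Set
  Spaced {n} σ S = (∀ s → s ∈ S → OccursAt τ σ s) ×
                   (∀ (s t : Fin n) → s ∈ S → t ∈ S → toℕ s < toℕ t → toℕ s + m ≤ toℕ t)

  StartsFrom : ∀ {n} → ℕ → Subset n → Set
  StartsFrom d S = ∀ p → p ∈ S → d ≤ toℕ p

  module _ {n} (x : Fin k) (σ : Word k n) (S : Subset n) where

    spaced-∷⁻ : ∀ {b} → Spaced (x ∷ σ) (b ∷ S) → Spaced σ S
    spaced-∷⁻ (occ , gap) =
        (λ s s∈S → occursAt-suc⁻ x σ s (occ (suc s) (there s∈S)))
      , (λ s t s∈S t∈S s<t → s≤s⁻¹ (gap (suc s) (suc t) (there s∈S) (there t∈S) (s≤s s<t)))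

    spaced-outside⁺ : Spaced σ S → Spaced (x ∷ σ) (outside ∷ S)
    spaced-outside⁺ (occ , gap) =
        (λ { (suc s) (there s∈S) → occursAt-suc⁺ x σ s (occ s s∈S) })
      , (λ { (suc s) (suc t) (there s∈S) (there t∈S) s<t → s≤s (gap s t s∈S t∈S (s≤s⁻¹ s<t)) })

    spaced-inside⁻ : Spaced (x ∷ σ) (inside ∷ S) → OccursAt τ (x ∷ σ) zero × StartsFrom (pred m) S
    spaced-inside⁻ (occ , gap) =
      occ zero here , λ t t∈S → pred-mono-≤ (gap zero (suc t) here (there t∈S) (s≤s z≤n))

    spaced-inside⁺ : OccursAt τ (x ∷ σ) zero → Spaced σ S → StartsFrom (pred m) S →
                     Spaced (x ∷ σ) (inside ∷ S)
    spaced-inside⁺ occ₀ (occ , gap) from =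
        (λ { zero _ → occ₀ ; (suc s) (there s∈S) → occursAt-suc⁺ x σ s (occ s s∈S) })
      , (λ { zero    (suc t) _          (there t∈S) _   → pred≤⇒≤suc (from t t∈S)
           ; (suc s) (suc t) (there s∈S) (there t∈S) s<t → s≤s (gap s t s∈S t∈S (s≤s⁻¹ s<t)) })

  startsFrom-outside⁺ : ∀ {n d} {S : Subset n} → StartsFrom d S → StartsFrom (suc d) (outside ∷ S)
  startsFrom-outside⁺ from (suc p) (there p∈S) = s≤s (from p p∈S)

  drop-start-before : ∀ {n} d → d ≤ m → (σ : Word k n) (S : Subset n) → Spaced σ S →
                      ∃[ S′ ] Spaced σ S′ × StartsFrom d S′ × ∣ S ∣ ≤ suc ∣ S′ ∣
  drop-start-before zero    _   σ       S            spaced = S , spaced , (λ _ _ → z≤n) , n≤1+n _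
  drop-start-before (suc d) _   []      []           spaced = [] , spaced , (λ ()) , z≤n
  drop-start-before (suc d) d<m (x ∷ σ) (outside ∷ S) spaced
    with S′ , spaced′ , from , size ← drop-start-before d (<⇒≤ d<m) σ S (spaced-∷⁻ x σ S spaced) =
    outside ∷ S′ , spaced-outside⁺ x σ S′ spaced′ , startsFrom-outside⁺ from , size
  drop-start-before (suc d) d<m (x ∷ σ) (inside ∷ S) spaced =
    outside ∷ S , spaced-outside⁺ x σ S (spaced-∷⁻ x σ S spaced) , startsFrom-outside⁺ from , ≤-refl
    where
    from : StartsFrom d S
    from p p∈S = ≤-trans (pred-mono-≤ d<m) (proj₂ (spaced-inside⁻ x σ S spaced) p p∈S)

  -- Exchange argument: if S does not use the occurrence at 0, dropping the first start of S
  -- loses one element and makes room for it.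
  greedy-upper : ∀ {n} d (σ : Word k n) S → Spaced σ S → StartsFrom d S → ∣ S ∣ ≤ greedy d σ
  greedy-upper d       []      []            _      _    = z≤n
  greedy-upper (suc d) (x ∷ σ) (inside ∷ S)  _      from with () ← from zero here
  greedy-upper (suc d) (x ∷ σ) (outside ∷ S) spaced from =
    greedy-upper d σ S (spaced-∷⁻ x σ S spaced) (λ p p∈S → s≤s⁻¹ (from (suc p) (there p∈S)))
  greedy-upper zero    (x ∷ σ) S             spaced _    with occursAt? τ (x ∷ σ) zero
  greedy-upper zero (x ∷ σ) (inside ∷ S)  spaced _ | yes _ =
    s≤s (greedy-upper (pred m) σ S (spaced-∷⁻ x σ S spaced) (proj₂ (spaced-inside⁻ x σ S spaced)))
  greedy-upper zero (x ∷ σ) (outside ∷ S) spaced _ | yes _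
    with S′ , spaced′ , from′ , size ←
           drop-start-before (pred m) pred[n]≤n σ S (spaced-∷⁻ x σ S spaced) =
    ≤-trans size (s≤s (greedy-upper (pred m) σ S′ spaced′ from′))
  greedy-upper zero (x ∷ σ) (inside ∷ S)  spaced _ | no ¬occ =
    ⊥-elim (¬occ (proj₁ (spaced-inside⁻ x σ S spaced)))
  greedy-upper zero (x ∷ σ) (outside ∷ S) spaced _ | no _    =
    greedy-upper zero σ S (spaced-∷⁻ x σ S spaced) (λ _ _ → z≤n)

  greedy-attained : ∀ {n} d (σ : Word k n) →
                    ∃[ S ] Spaced σ S × StartsFrom d S × ∣ S ∣ ≡ greedy d σ
  greedy-attained d       []      = [] , ((λ ()) , (λ ())) , (λ ()) , refl
  greedy-attained (suc d) (x ∷ σ) with S , spaced , from , size ← greedy-attained d σ =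
    outside ∷ S , spaced-outside⁺ x σ S spaced , startsFrom-outside⁺ from , size
  greedy-attained zero    (x ∷ σ) with occursAt? τ (x ∷ σ) zero
  ... | yes occ with S , spaced , from , size ← greedy-attained (pred m) σ =
    inside ∷ S , spaced-inside⁺ x σ S occ spaced from , (λ _ _ → z≤n) , cong suc size
  ... | no _    with S , spaced , _ , size ← greedy-attained zero σ =
    outside ∷ S , spaced-outside⁺ x σ S spaced , (λ _ _ → z≤n) , size

  spaced⇒nonOverlapping : ∀ {n} (σ : Word k n) S → Spaced σ S → NonOverlapping τ σ S
  spaced⇒nonOverlapping {n} σ S (occ , gap) = occ , disjoint
    where
    disjoint : ∀ (s t : Fin n) → s ∈ S → t ∈ S → s ≢ t → ∀ p → ¬ (InOcc m s p × InOcc m t p)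
    disjoint s t s∈S t∈S s≢t p ((s≤p , p<s+m) , (t≤p , p<t+m)) with <-cmp (toℕ s) (toℕ t)
    ... | tri< s<t _ _ = <-irrefl refl (<-≤-trans p<s+m (≤-trans (gap s t s∈S t∈S s<t) t≤p))
    ... | tri≈ _ s≡t _ = s≢t (toℕ-injective s≡t)
    ... | tri> _ _ t<s = <-irrefl refl (<-≤-trans p<t+m (≤-trans (gap t s t∈S s∈S t<s) s≤p))

  nonOverlapping⇒spaced : 1 ≤ m → ∀ {n} (σ : Word k n) S → NonOverlapping τ σ S → Spaced σ S
  nonOverlapping⇒spaced 1≤m σ S (occ , disjoint) = occ , λ s t s∈S t∈S s<t → ≮⇒≥ λ t<s+m →
    disjoint s t s∈S t∈S (λ s≡t → <-irrefl (cong toℕ s≡t) s<t) t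
      ((<⇒≤ s<t , t<s+m) , (≤-refl , m<m+n (toℕ t) 1≤m))

  N≡greedy : 1 ≤ m → ∀ {n} (σ : Word k n) → N τ σ ≡ greedy 0 σ
  N≡greedy 1≤m {n} σ = ≤-antisym
    (maxList-≤ (map⁺ (All.map (λ {S} → bounded S) (all-filter (nonOverlapping? τ σ) (subsets n)))))
    attained
    where
    bounded : ∀ S → NonOverlapping τ σ S → ∣ S ∣ ≤ greedy 0 σ
    bounded S nonOv = greedy-upper 0 σ S (nonOverlapping⇒spaced 1≤m σ S nonOv) (λ _ _ → z≤n)

    everyBit : ∀ b → b ∈ˡ inside ∷ outside ∷ []
    everyBit inside  = Any.here refl
    everyBit outside = Any.there (Any.here refl)

    attained : greedy 0 σ ≤ N τ σ
    attained with S , spaced , _ , size ← greedy-attained 0 σ =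
      subst (_≤ N τ σ) size (≤-maxList (∈-map⁺ ∣_∣ (∈-filter⁺ (nonOverlapping? τ σ)
        (∈-allVec _ everyBit S) (spaced⇒nonOverlapping σ S spaced))))

  N-++ : 1 ≤ m → ∀ {t r} (u : Word k t) (w : Word k r) →
         firstEnd u ≡ just t → N τ (u Vec.++ w) ≡ suc (N τ w)
  N-++ 1≤m u w ends = begin
    N τ (u Vec.++ w)         ≡⟨ N≡greedy 1≤m (u Vec.++ w) ⟩
    greedy 0 (u Vec.++ w)    ≡⟨ greedy-++ u w ends ⟩
    suc (greedy 0 w)         ≡⟨ cong suc (N≡greedy 1≤m w) ⟨
    suc (N τ w)              ∎
    where open ≡-Reasoning

-- Counting words

module _ {ℓ m : ℕ} (τ : Vec (Fin ℓ) m) (1≤m : 1 ≤ m) (k : ℕ) where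

  private
    firstEnd≟ : ∀ {n} e (σ : Word k n) → Dec (firstEnd τ σ ≡ just e)
    firstEnd≟ e σ = ≡-dec _≟_ (firstEnd τ σ) (just e)

    length-words-1 : length (words k 1) ≡ k
    length-words-1 = trans (length-allVec-1 (List.allFin k)) (List.length-tabulate _)

  firstAtEnd : ℕ → ℕ
  firstAtEnd t = count (firstEnd≟ t) (words k t)

  countN-zero : ∀ n → countN τ k n 0 ≡ a τ k n
  countN-zero n = count-≐ (λ σ → N τ σ ≟ 0) (avoids? τ) toAvoids fromAvoids (words k n)
    where
    toAvoids : ∀ (σ : Word k n) → N τ σ ≡ 0 → Avoids τ σ
    toAvoids σ N≡0 = firstEnd≡nothing⇒avoids τ σ
      (greedy≡0⇒firstEnd≡nothing τ σ (trans (sym (N≡greedy τ 1≤m σ)) N≡0))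

    fromAvoids : ∀ (σ : Word k n) → Avoids τ σ → N τ σ ≡ 0
    fromAvoids σ avoids = trans (N≡greedy τ 1≤m σ)
      (firstEnd≡nothing⇒greedy≡0 τ σ (avoids⇒firstEnd≡nothing τ σ avoids))

  firstAtEnd-suc : ∀ t → a τ k (suc t) + firstAtEnd (suc t) ≡ k * a τ k t
  firstAtEnd-suc t = begin
    a τ k (suc t) + firstAtEnd (suc t)
      ≡⟨ count-∪ (avoids? τ) (firstEnd≟ (suc t)) disjoint (words k (suc t)) ⟨
    count (avoidsOrEnds (suc t)) (words k (suc t))
      ≡⟨ cong (λ n → count (avoidsOrEnds n) (words k n)) (+-comm 1 t) ⟩
    count (avoidsOrEnds (t + 1)) (words k (t + 1))
      ≡⟨ count-allVec-++ (List.allFin k) t 1 (avoidsOrEnds (t + 1)) ⟩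
    sum (map extensions (words k t))
      ≡⟨ sum-indicator (avoids? τ) extensions k avoiding nonAvoiding (words k t) ⟩
    a τ k t * k
      ≡⟨ *-comm (a τ k t) k ⟩
    k * a τ k t ∎
    where
    open ≡-Reasoning
    avoidsOrEnds : ∀ n → Decidable (λ (σ : Word k n) → Avoids τ σ ⊎ firstEnd τ σ ≡ just n)
    avoidsOrEnds n = avoids? τ ∪? firstEnd≟ n

    disjoint : ∀ {n} (σ : Word k n) → Avoids τ σ → ¬ firstEnd τ σ ≡ just n
    disjoint σ avoids ends with () ← trans (sym ends) (avoids⇒firstEnd≡nothing τ σ avoids)

    extensions : Word k t → ℕ
    extensions u = count (λ w → avoidsOrEnds (t + 1) (u Vec.++ w)) (words k 1)

    avoiding : ∀ u → Avoids τ u → extensions u ≡ k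
    avoiding u avoids =
      trans (count-all (λ w → avoidsOrEnds (t + 1) (u Vec.++ w)) extend (words k 1)) length-words-1
      where
      extend : ∀ w → Avoids τ (u Vec.++ w) ⊎ firstEnd τ (u Vec.++ w) ≡ just (t + 1)
      extend w with firstEnd τ (u Vec.++ w) in ends
      ... | nothing = inj₁ (firstEnd≡nothing⇒avoids τ (u Vec.++ w) ends)
      ... | just e with e ≤? t
      ...   | yes e≤t with () ←
        trans (sym (firstEnd-++⁻ τ 1≤m u w ends e≤t)) (avoids⇒firstEnd≡nothing τ u avoids)
      ...   | no  e≰t = inj₂ (cong just (≤-antisym (proj₂ (firstEnd-bounds τ (u Vec.++ w) ends))
                                                  (subst (_≤ e) (+-comm 1 t) (≰⇒> e≰t))))

    nonAvoiding : ∀ u → ¬ Avoids τ u → extensions u ≡ 0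
    nonAvoiding u ¬avoids with firstEnd τ u in ends
    ... | nothing = ⊥-elim (¬avoids (firstEnd≡nothing⇒avoids τ u ends))
    ... | just e  = count-none (λ w → avoidsOrEnds (t + 1) (u Vec.++ w)) neither (words k 1)
      where
      neither : ∀ w → ¬ (Avoids τ (u Vec.++ w) ⊎ firstEnd τ (u Vec.++ w) ≡ just (t + 1))
      neither w (inj₁ avoids) with () ←
        trans (sym (firstEnd-++⁺ τ u w ends)) (avoids⇒firstEnd≡nothing τ (u Vec.++ w) avoids)
      neither w (inj₂ ends′) with refl ← trans (sym (firstEnd-++⁺ τ u w ends)) ends′ =
        1+n≰n (subst (_≤ t) (+-comm t 1) (proj₂ (firstEnd-bounds τ u ends)))

  firstAtEnd-generating : ∀ t →
    ((((const (+ k) ⊗ X) ⊖ const (+ 1)) ⊗ Aser τ k) ⊕ const (+ 1)) t ≡ + firstAtEnd t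
  firstAtEnd-generating zero    = [cX-1]f+1-zero (+ k) (Aser τ k)
  firstAtEnd-generating (suc t) = begin
    ((((const (+ k) ⊗ X) ⊖ const (+ 1)) ⊗ Aser τ k) ⊕ const (+ 1)) (suc t)
      ≡⟨ [cX-1]f+1-suc (+ k) (Aser τ k) t ⟩
    + k ℤ.* + a τ k t - + a τ k (suc t)
      ≡⟨ cong (λ z → z - + a τ k (suc t)) (ℤₚ.pos-* k (a τ k t)) ⟨
    + (k * a τ k t) - + a τ k (suc t)
      ≡⟨ cong (λ z → + z - + a τ k (suc t)) (firstAtEnd-suc t) ⟨
    + (a τ k (suc t) + firstAtEnd (suc t)) - + a τ k (suc t)
      ≡⟨ cong (λ z → z - + a τ k (suc t)) (ℤₚ.pos-+ (a τ k (suc t)) (firstAtEnd (suc t))) ⟩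
    + a τ k (suc t) ℤ.+ + firstAtEnd (suc t) - + a τ k (suc t)
      ≡⟨ xyx⁻¹≈y (+ a τ k (suc t)) (+ firstAtEnd (suc t)) ⟩
    + firstAtEnd (suc t) ∎
    where
    open ≡-Reasoning
    open Algebra.Properties.AbelianGroup ℤₚ.+-0-abelianGroup using (xyx⁻¹≈y)

  countN-++ : ∀ t r j → count (λ σ → (N τ σ ≟ suc j) ×-dec firstEnd≟ t σ) (words k (t + r))
                      ≡ firstAtEnd t * countN τ k r j
  countN-++ t r j =
    trans (count-allVec-++ (List.allFin k) t r (λ σ → (N τ σ ≟ suc j) ×-dec firstEnd≟ t σ))
          (sum-indicator (firstEnd≟ t) tails (countN τ k r j) endsAt notEndsAt (words k t))
    where
    tailsWith : ∀ (u : Word k t) →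
                Decidable (λ (w : Word k r) → N τ (u Vec.++ w) ≡ suc j × firstEnd τ (u Vec.++ w) ≡ just t)
    tailsWith u w = (N τ (u Vec.++ w) ≟ suc j) ×-dec firstEnd≟ t (u Vec.++ w)

    tails : Word k t → ℕ
    tails u = count (tailsWith u) (words k r)

    endsAt : ∀ u → firstEnd τ u ≡ just t → tails u ≡ countN τ k r j
    endsAt u ends = count-≐ (tailsWith u) (λ w → N τ w ≟ j)
      (λ w (N≡1+j , _) → suc-injective (trans (sym (N-++ τ 1≤m u w ends)) N≡1+j))
      (λ w N≡j → trans (N-++ τ 1≤m u w ends) (cong suc N≡j) , firstEnd-++⁺ τ u w ends)
      (words k r)

    notEndsAt : ∀ u → ¬ firstEnd τ u ≡ just t → tails u ≡ 0
    notEndsAt u ¬ends =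
      count-none (tailsWith u) (λ w (_ , ends) → ¬ends (firstEnd-++⁻ τ 1≤m u w ends ≤-refl)) (words k r)

  countN-suc : ∀ n j → + countN τ k n (suc j) ≡ ((λ i → + countN τ k i j) ⊗ (λ t → + firstAtEnd t)) n
  countN-suc n j = begin
    + countN τ k n (suc j)
      ≡⟨ count-by-value (λ σ → N τ σ ≟ suc j) rest n
                        (λ σ → m∸n≤m n (fromMaybe 0 (firstEnd τ σ))) (words k n) ⟩
    sumTo n (λ i → + count (λ σ → (N τ σ ≟ suc j) ×-dec (rest σ ≟ i)) (words k n))
      ≡⟨ sumTo-cong n (λ i≤n → cong +_ (byRest i≤n)) ⟩
    sumTo n (λ i → + (countN τ k i j * firstAtEnd (n ∸ i)))
      ≡⟨ sumTo-cong n (λ {i} _ → ℤₚ.pos-* (countN τ k i j) (firstAtEnd (n ∸ i))) ⟩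
    ((λ i → + countN τ k i j) ⊗ (λ t → + firstAtEnd t)) n ∎
    where
    open ≡-Reasoning
    rest : Word k n → ℕ
    rest σ = n ∸ fromMaybe 0 (firstEnd τ σ)

    byRest : ∀ {i} → i ≤ n → count (λ σ → (N τ σ ≟ suc j) ×-dec (rest σ ≟ i)) (words k n)
                             ≡ countN τ k i j * firstAtEnd (n ∸ i)
    byRest {i} i≤n = begin
      count (λ σ → (N τ σ ≟ suc j) ×-dec (rest σ ≟ i)) (words k n)
        ≡⟨ count-≐ _ (firstAfter (n ∸ i)) toEnd fromEnd (words k n) ⟩
      count (firstAfter (n ∸ i)) (words k n)
        ≡⟨ cong (λ l → count (firstAfter (n ∸ i)) (words k l)) (m∸n+n≡m i≤n) ⟨
      count (firstAfter (n ∸ i)) (words k (n ∸ i + i))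
        ≡⟨ countN-++ (n ∸ i) i j ⟩
      firstAtEnd (n ∸ i) * countN τ k i j
        ≡⟨ *-comm (firstAtEnd (n ∸ i)) (countN τ k i j) ⟩
      countN τ k i j * firstAtEnd (n ∸ i) ∎
      where
      firstAfter : ∀ t {l} → Decidable (λ (σ : Word k l) → N τ σ ≡ suc j × firstEnd τ σ ≡ just t)
      firstAfter t σ = (N τ σ ≟ suc j) ×-dec firstEnd≟ t σ

      toEnd : ∀ σ → N τ σ ≡ suc j × rest σ ≡ i → N τ σ ≡ suc j × firstEnd τ σ ≡ just (n ∸ i)
      toEnd σ (N≡1+j , rest≡i) with firstEnd τ σ in ends
      ... | nothing with () ←
        trans (sym N≡1+j) (trans (N≡greedy τ 1≤m σ) (firstEnd≡nothing⇒greedy≡0 τ σ ends))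
      ... | just e  =
        N≡1+j , cong just (trans (sym (m∸[m∸n]≡n (proj₂ (firstEnd-bounds τ σ ends)))) (cong (n ∸_) rest≡i))

      fromEnd : ∀ σ → N τ σ ≡ suc j × firstEnd τ σ ≡ just (n ∸ i) → N τ σ ≡ suc j × rest σ ≡ i
      fromEnd σ (N≡1+j , ends) = N≡1+j , trans (cong (λ x → n ∸ fromMaybe 0 x) ends) (m∸[m∸n]≡n i≤n)

mainTheorem13 : ∀ {ℓ m : ℕ} (τ : Vec (Fin ℓ) m) → 1 ≤ m →
    (∀ (c : Fin ℓ) → ∃ λ i → lookup τ i ≡ c) →
    ∀ (k : ℕ) → 1 ≤ k →
    ∀ (n j : ℕ) → (Fser τ k ⊗₂ Dser τ k) n j ≡ lift (Aser τ k) n j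
mainTheorem13 τ 1≤m _ k _ n zero = begin
  (Fser τ k ⊗₂ 1-Y⊗ B) n 0  ≡⟨ ⊗₂-1-Y⊗-zero B (Fser τ k) n ⟩
  + countN τ k n 0          ≡⟨ cong +_ (countN-zero τ 1≤m k n) ⟩
  + a τ k n                 ∎
  where
  open ≡-Reasoning
  B : Series
  B = (((const (+ k) ⊗ X) ⊖ const (+ 1)) ⊗ Aser τ k) ⊕ const (+ 1)
mainTheorem13 τ 1≤m _ k _ n (suc j) = begin
  (Fser τ k ⊗₂ 1-Y⊗ B) n (suc j)           ≡⟨ ⊗₂-1-Y⊗-suc B (Fser τ k) n j ⟩
  + countN τ k n (suc j) - (Fⱼ ⊗ B) n      ≡⟨ cong (λ z → + countN τ k n (suc j) - z) B≡b ⟩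
  + countN τ k n (suc j) - (Fⱼ ⊗ b) n      ≡⟨ cong (λ z → z - (Fⱼ ⊗ b) n) (countN-suc τ 1≤m k n j) ⟩
  (Fⱼ ⊗ b) n - (Fⱼ ⊗ b) n                  ≡⟨ ℤₚ.+-inverseʳ ((Fⱼ ⊗ b) n) ⟩
  0ℤ                                       ∎
  where
  open ≡-Reasoning
  B b Fⱼ : Series
  B     = (((const (+ k) ⊗ X) ⊖ const (+ 1)) ⊗ Aser τ k) ⊕ const (+ 1)
  b t   = + firstAtEnd τ 1≤m k t
  Fⱼ i  = + countN τ k i j

  B≡b : (Fⱼ ⊗ B) n ≡ (Fⱼ ⊗ b) n
  B≡b = ⊗-congʳ Fⱼ (firstAtEnd-generating τ 1≤m k) n
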